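{- Let $n$, $a$ and $t$ be positive integers and let $b=\gcd(n,a)$. If $n\nmid tb$, then $$ \sum_{\substack{d\mid n\\ \gcd(d,ta)=\gcd(d,t)}}\mu(n/d)\,a^{\gcd(d,t)}=0. $$
   Context: $\mu$ denotes the Möbius function, and the sum runs over the positive divisors $d$ of $n$ satisfying $\gcd(d,ta)=\gcd(d,t)$. -}

module Defs where

open import Data.Nat using (ℕ; zero; suc; _*_; _/_; NonZero)
open import Data.Nat.Divisibility using (_∣_; _∣?_)
open import Data.Nat.GCD using (gcd)
open import Data.Nat.Primality using (prime?)
open import Data.Nat.Properties using (_≟_)
open import Data.List using (List; filter; upTo; length; map; foldr)
open import Data.Integer as ℤ using (ℤ; +_)
open import Relation.Nullary using (does; ¬?)
open import Relation.Nullary.Decidable using (_×-dec_)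
open import Data.Bool using (if_then_else_)

-- positive divisors of n, written as suc k (k < n) so that they are visibly nonzero
divisorsPred : ℕ → List ℕ
divisorsPred n = filter (λ k → suc k ∣? n) (upTo n)

primeDivisors : ℕ → List ℕ
primeDivisors n = filter (λ p → prime? p ×-dec (p ∣? n)) (map suc (upTo n))

squarefree? : ℕ → Data.Bool.Bool
squarefree? n = foldr (λ p b → Data.Bool.not (does ((p * p) ∣? n)) Data.Bool.∧ b) Data.Bool.true (primeDivisors n)

-- Möbius function: μ(n) = (-1)^(number of prime divisors) if n squarefree, else 0
-- (only used for n ≥ 1)
μ : ℕ → ℤ
μ n = if squarefree? n then (ℤ.- (+ 1)) ℤ.^ length (primeDivisors n) else + 0

∑ℤ : List ℤ → ℤ
∑ℤ = foldr ℤ._+_ (+ 0)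

lemma3Sum : (n a t : ℕ) → ℤ
lemma3Sum n a t =
  ∑ℤ (map (λ k → μ (n / suc k) ℤ.* ((+ a) ℤ.^ gcd (suc k) t))
          (filter (λ k → gcd (suc k) (t * a) ≟ gcd (suc k) t) (divisorsPred n)))

-- Write the sum as (μ ⋆ F)(n) = ∑_{d ∣ n} μ(n/d) F(d) with
-- F(d) = [gcd(d,ta) = gcd(d,t)] a^gcd(d,t). Since n ∤ tb, some exact prime power
-- p^(e+1) ∥ n, say n = p^(e+1) m with p ∤ m, does not divide tb. If p^e ∤ d then
-- p² ∣ n/d and μ(n/d) = 0, so the surviving divisors come in pairs c p^(e+1), c p^e
-- with c ∣ m, whose Möbius coefficients μ(m/c) and μ(p m/c) = −μ(m/c) are opposite.
-- The pairs cancel because F(c p^(e+1)) = F(c p^e): if p ∤ a, then p^(e+1) divides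
-- neither t nor ta, so multiplying d by p changes neither gcd; if p ∣ a, then
-- p^e ∤ t and p·gcd(d,t) divides gcd(d,ta) for both divisors, so F vanishes on both.

{-# OPTIONS --safe #-}
module Submission where

open import Defs
import Algebra.Properties.CommutativeSemigroup as CSemigroup
open import Data.Bool using (true; false; if_then_else_; not; _∧_)
open import Data.Integer as ℤ using (ℤ; +_; -_)
import Data.Integer.Properties as ℤ
open import Data.List using (List; []; _∷_; [_]; _++_; filter; upTo; map; length; foldr)
import Data.List.Properties as List
open import Data.Nat as ℕ using (ℕ; zero; suc; _+_; _*_; _^_; _<_; _≤_; _>_; s≤s; NonZero; NonTrivial)
open import Data.Nat.Divisibility
open import Data.Nat.Properties as ℕ using (_≟_)
open import Data.Nat.Coprimality as Coprime using (Coprime; coprime-divisor)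
open import Data.Nat.GCD using (gcd; gcd[m,n]∣m; gcd[m,n]∣n; gcd-greatest; gcd[m,n]≢0)
open import Data.Nat.Primality using (Prime; prime?; prime⇒irreducible; prime⇒nonZero; prime⇒nonTrivial; euclidsLemma; ¬prime[0]; ¬prime[1])
open import Data.Nat.Primality.Factorisation using (factorise)
open import Data.Nat.Induction using (<-rec)
open import Data.Nat.DivMod using (_/_; m*n/n≡m)
open import Data.Nat.Tactic.RingSolver using (solve-∀)
open import Data.List.Relation.Unary.All using (_∷_)
open import Data.List.Relation.Unary.Any using (Any; any?)
open import Data.List.Membership.Propositional using (_∈_; find; lose)
open import Data.List.Membership.Propositional.Properties using (∈-filter⁺; ∈-filter⁻; ∈-map⁺; ∈-upTo⁺)
open import Data.Product using (_×_; _,_; proj₁; proj₂; Σ-syntax)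
open import Data.Sum using (inj₁; inj₂; [_,_]′)
open import Function.Bundles using (mk⇔)
open import Function using (_∘_; flip; it)
open import Relation.Binary.PropositionalEquality hiding ([_])
open import Relation.Nullary using (¬_; Dec; yes; no; does; contradiction)
open import Relation.Nullary.Decidable using (dec-true; dec-false; does-⇔; _×-dec_)
open import Relation.Unary using (Decidable)

open ≡-Reasoning
open CSemigroup ℤ.+-commutativeSemigroup using (interchange)
module ℕ* = CSemigroup ℕ.*-commutativeSemigroup


-- Finite sums f 1 + ⋯ + f N

sumTo : (ℕ → ℤ) → ℕ → ℤ
sumTo f zero    = + 0
sumTo f (suc N) = sumTo f N ℤ.+ f (suc N)

sumTo-cong : ∀ {f g} N → (∀ k → k < N → f (suc k) ≡ g (suc k)) → sumTo f N ≡ sumTo g N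
sumTo-cong zero    f≗g = refl
sumTo-cong (suc N) f≗g =
  cong₂ ℤ._+_ (sumTo-cong N λ k k<N → f≗g k (ℕ.m<n⇒m<1+n k<N)) (f≗g N ℕ.≤-refl)

sumTo-zero : ∀ {f} N → (∀ k → k < N → f (suc k) ≡ + 0) → sumTo f N ≡ + 0
sumTo-zero zero    f≗0 = refl
sumTo-zero (suc N) f≗0 =
  cong₂ ℤ._+_ (sumTo-zero N λ k k<N → f≗0 k (ℕ.m<n⇒m<1+n k<N)) (f≗0 N ℕ.≤-refl)

sumTo-+ : ∀ f g N → sumTo (λ i → f i ℤ.+ g i) N ≡ sumTo f N ℤ.+ sumTo g N
sumTo-+ f g zero    = refl
sumTo-+ f g (suc N) = trans (cong (ℤ._+ (f (suc N) ℤ.+ g (suc N))) (sumTo-+ f g N))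
                            (interchange (sumTo f N) (sumTo g N) (f (suc N)) (g (suc N)))

sumTo-+ℕ : ∀ f A B → sumTo f (A + B) ≡ sumTo f A ℤ.+ sumTo (λ i → f (A + i)) B
sumTo-+ℕ f A zero    = trans (cong (sumTo f) (ℕ.+-identityʳ A)) (sym (ℤ.+-identityʳ _))
sumTo-+ℕ f A (suc B) rewrite ℕ.+-suc A B =
  trans (cong (ℤ._+ f (suc (A + B))) (sumTo-+ℕ f A B)) (ℤ.+-assoc (sumTo f A) _ _)

sumTo-extend : ∀ {f} m N → m ≤ N → (∀ k → m ≤ k → k < N → f (suc k) ≡ + 0) →
               sumTo f N ≡ sumTo f m
sumTo-extend zero    zero    _     _   = refl
sumTo-extend (suc m) zero    ()    _
sumTo-extend m       (suc N) m≤1+N f≗0 with ℕ.m≤n⇒m<n∨m≡n m≤1+N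
... | inj₂ refl    = refl
... | inj₁ m<1+N = begin
  sumTo _ N ℤ.+ _ ≡⟨ cong₂ ℤ._+_ (sumTo-extend m N m≤N λ k m≤k k<N → f≗0 k m≤k (ℕ.m<n⇒m<1+n k<N))
                                 (f≗0 N m≤N ℕ.≤-refl) ⟩
  sumTo _ m ℤ.+ + 0 ≡⟨ ℤ.+-identityʳ _ ⟩
  sumTo _ m ∎
  where m≤N = ℕ.s≤s⁻¹ m<1+N

𝟙 : ∀ {P : ℕ → Set} → Decidable P → ℕ → ℤ
𝟙 P? x = if does (P? x) then + 1 else + 0

sumTo-𝟙[≟] : ∀ p N → .{{NonZero p}} → p ≤ N → sumTo (𝟙 (_≟ p)) N ≡ + 1
sumTo-𝟙[≟] p@(suc p′) N p≤N = begin
  sumTo (𝟙 (_≟ p)) N                   ≡⟨ sumTo-extend p N p≤N (λ k p≤k _ → 𝟙-≢ k (ℕ.<⇒≢ (s≤s p≤k) ∘ sym)) ⟩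
  sumTo (𝟙 (_≟ p)) p′ ℤ.+ 𝟙 (_≟ p) p   ≡⟨ cong₂ ℤ._+_ (sumTo-zero p′ (λ k k<p′ → 𝟙-≢ k (ℕ.<⇒≢ (s≤s k<p′))))
                                                      (cong (if_then + 1 else + 0) (dec-true (p ≟ p) refl)) ⟩
  + 1                                  ∎
  where
  𝟙-≢ : ∀ k → suc k ≢ p → 𝟙 (_≟ p) (suc k) ≡ + 0
  𝟙-≢ k k≢p = cong (if_then + 1 else + 0) (dec-false (suc k ≟ p) k≢p)

offMultiples : ℕ → (ℕ → ℤ) → ℕ → ℤ
offMultiples r f d = if does (r ∣? d) then + 0 else f d

sumTo-lastBlock : ∀ f r .{{_ : NonZero r}} M →
                  sumTo (λ i → f (M * r + i)) r ≡
                  sumTo (λ i → offMultiples r f (M * r + i)) r ℤ.+ f (suc M * r)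
sumTo-lastBlock f r@(suc r′) M = begin
  sumTo g r′ ℤ.+ f (M * r + r)
    ≡⟨ cong₂ ℤ._+_ (sumTo-cong r′ off-inside) (cong f (ℕ.+-comm (M * r) r)) ⟩
  sumTo g′ r′ ℤ.+ f (suc M * r)
    ≡⟨ cong (ℤ._+ f (suc M * r)) (sym (ℤ.+-identityʳ (sumTo g′ r′))) ⟩
  (sumTo g′ r′ ℤ.+ + 0) ℤ.+ f (suc M * r)
    ≡⟨ cong (λ z → (sumTo g′ r′ ℤ.+ z) ℤ.+ f (suc M * r)) (sym off-last) ⟩
  sumTo g′ r ℤ.+ f (suc M * r) ∎
  where
  g g′ : ℕ → ℤ
  g  i = f (M * r + i)
  g′ i = offMultiples r f (M * r + i)
  off-last : g′ r ≡ + 0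
  off-last = cong (if_then + 0 else g r) (dec-true (r ∣? M * r + r) (∣m∣n⇒∣m+n (n∣m*n M) ∣-refl))
  off-inside : ∀ k → k < r′ → g (suc k) ≡ g′ (suc k)
  off-inside k k<r′ = cong (if_then + 0 else g (suc k)) (sym (dec-false (r ∣? M * r + suc k) r∤))
    where
    r∤ : ¬ r ∣ M * r + suc k
    r∤ r∣ = ℕ.<⇒≱ (s≤s k<r′) (∣⇒≤ (∣m+n∣m⇒∣n r∣ (n∣m*n M)))

sumTo-*-split : ∀ f r .{{_ : NonZero r}} M → sumTo f (M * r) ≡
                sumTo (λ j → f (j * r)) M ℤ.+ sumTo (offMultiples r f) (M * r)
sumTo-*-split f r zero    = refl
sumTo-*-split f r (suc M) = begin
  sumTo f (r + M * r)
    ≡⟨ cong (sumTo f) (ℕ.+-comm r (M * r)) ⟩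
  sumTo f (M * r + r)
    ≡⟨ sumTo-+ℕ f (M * r) r ⟩
  sumTo f (M * r) ℤ.+ sumTo (λ i → f (M * r + i)) r
    ≡⟨ cong₂ ℤ._+_ (sumTo-*-split f r M) (trans (sumTo-lastBlock f r M) (ℤ.+-comm Σlast _)) ⟩
  (Σon ℤ.+ Σoff) ℤ.+ (f (suc M * r) ℤ.+ Σlast)
    ≡⟨ interchange Σon Σoff (f (suc M * r)) Σlast ⟩
  (Σon ℤ.+ f (suc M * r)) ℤ.+ (Σoff ℤ.+ Σlast)
    ≡⟨ cong (ℤ._+_ (Σon ℤ.+ f (suc M * r))) (sym (sumTo-+ℕ (offMultiples r f) (M * r) r)) ⟩
  sumTo (λ j → f (j * r)) (suc M) ℤ.+ sumTo (offMultiples r f) (M * r + r)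
    ≡⟨ cong (λ N → sumTo (λ j → f (j * r)) (suc M) ℤ.+ sumTo (offMultiples r f) N) (ℕ.+-comm (M * r) r) ⟩
  sumTo (λ j → f (j * r)) (suc M) ℤ.+ sumTo (offMultiples r f) (suc M * r) ∎
  where
  Σon Σoff Σlast : ℤ
  Σon   = sumTo (λ j → f (j * r)) M
  Σoff  = sumTo (offMultiples r f) (M * r)
  Σlast = sumTo (λ i → offMultiples r f (M * r + i)) r

sumTo-*-multiples : ∀ f r .{{_ : NonZero r}} M → (∀ d → ¬ r ∣ d → f d ≡ + 0) →
                    sumTo f (M * r) ≡ sumTo (λ j → f (j * r)) M
sumTo-*-multiples f r M f≗0 = begin
  sumTo f (M * r)                             ≡⟨ sumTo-*-split f r M ⟩
  Σon ℤ.+ sumTo (offMultiples r f) (M * r)     ≡⟨ cong (ℤ._+_ Σon) (sumTo-zero (M * r) off≗0) ⟩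
  Σon ℤ.+ + 0                                 ≡⟨ ℤ.+-identityʳ Σon ⟩
  Σon                                         ∎
  where
  Σon : ℤ
  Σon = sumTo (λ j → f (j * r)) M
  off≗0 : ∀ k → k < M * r → offMultiples r f (suc k) ≡ + 0
  off≗0 k _ with r ∣? suc k
  ... | yes _   = refl
  ... | no r∤ = f≗0 (suc k) r∤


∑ℤ-filter : ∀ {A : Set} {P : A → Set} (P? : Decidable P) (f : A → ℤ) xs →
            ∑ℤ (map f (filter P? xs)) ≡ ∑ℤ (map (λ x → if does (P? x) then f x else + 0) xs)
∑ℤ-filter P? f []       = refl
∑ℤ-filter P? f (x ∷ xs) with does (P? x)
... | true  = cong (ℤ._+_ (f x)) (∑ℤ-filter P? f xs)
... | false = trans (∑ℤ-filter P? f xs) (sym (ℤ.+-identityˡ _))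

∑ℤ-++ : ∀ xs ys → ∑ℤ (xs ++ ys) ≡ ∑ℤ xs ℤ.+ ∑ℤ ys
∑ℤ-++ []       ys = sym (ℤ.+-identityˡ _)
∑ℤ-++ (x ∷ xs) ys = trans (cong (ℤ._+_ x) (∑ℤ-++ xs ys)) (sym (ℤ.+-assoc x _ _))

∑ℤ-upTo : ∀ f N → ∑ℤ (map (λ k → f (suc k)) (upTo N)) ≡ sumTo f N
∑ℤ-upTo f zero    = refl
∑ℤ-upTo f (suc N) = begin
  ∑ℤ (map g (upTo (suc N)))       ≡⟨ cong (∑ℤ ∘ map g) (sym (List.upTo-∷ʳ N)) ⟩
  ∑ℤ (map g (upTo N ++ [ N ]))    ≡⟨ cong ∑ℤ (List.map-++ g (upTo N) [ N ]) ⟩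
  ∑ℤ (map g (upTo N) ++ [ g N ])  ≡⟨ ∑ℤ-++ (map g (upTo N)) [ g N ] ⟩
  ∑ℤ (map g (upTo N)) ℤ.+ (g N ℤ.+ + 0) ≡⟨ cong₂ ℤ._+_ (∑ℤ-upTo f N) (ℤ.+-identityʳ (g N)) ⟩
  sumTo f N ℤ.+ g N               ∎
  where
  g : ℕ → ℤ
  g k = f (suc k)

∑ℤ-const1 : ∀ {A : Set} (xs : List A) → ∑ℤ (map (λ _ → + 1) xs) ≡ + length xs
∑ℤ-const1 []       = refl
∑ℤ-const1 (x ∷ xs) = cong (ℤ._+_ (+ 1)) (∑ℤ-const1 xs)

length-filter-upTo : ∀ {P : ℕ → Set} (P? : Decidable P) N →
                     + length (filter P? (map suc (upTo N))) ≡ sumTo (𝟙 P?) N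
length-filter-upTo P? N = begin
  + length (filter P? (map suc (upTo N)))            ≡⟨ sym (∑ℤ-const1 (filter P? (map suc (upTo N)))) ⟩
  ∑ℤ (map (λ _ → + 1) (filter P? (map suc (upTo N)))) ≡⟨ ∑ℤ-filter P? (λ _ → + 1) (map suc (upTo N)) ⟩
  ∑ℤ (map (𝟙 P?) (map suc (upTo N)))                 ≡⟨ cong ∑ℤ (sym (List.map-∘ (upTo N))) ⟩
  ∑ℤ (map (λ k → 𝟙 P? (suc k)) (upTo N))             ≡⟨ ∑ℤ-upTo (𝟙 P?) N ⟩
  sumTo (𝟙 P?) N                                     ∎


-- Divisibility by prime powers

prime⇒n>1 : ∀ {p} → Prime p → 1 < p
prime⇒n>1 {p} p-prime = ℕ.nonTrivial⇒n>1 p {{prime⇒nonTrivial p-prime}}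

prime∤⇒coprime : ∀ {p m} → Prime p → ¬ p ∣ m → Coprime p m
prime∤⇒coprime p-prime p∤m (d∣p , d∣m) with prime⇒irreducible p-prime d∣p
... | inj₁ d≡1 = d≡1
... | inj₂ refl = contradiction d∣m p∤m

p∣m^i⇒p∣m : ∀ {p} → Prime p → ∀ m i → p ∣ m ^ i → p ∣ m
p∣m^i⇒p∣m p-prime m zero    p∣1 = contradiction (∣1⇒≡1 p∣1) (λ { refl → ¬prime[1] p-prime })
p∣m^i⇒p∣m p-prime m (suc i) p∣m*m^i with euclidsLemma m (m ^ i) p-prime p∣m*m^i
... | inj₁ p∣m   = p∣m
... | inj₂ p∣m^i = p∣m^i⇒p∣m p-prime m i p∣m^i

p^i∣m*n⇒p^i∣m : ∀ {p n} → Prime p → ¬ p ∣ n → ∀ i {m} → p ^ i ∣ m * n → p ^ i ∣ m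
p^i∣m*n⇒p^i∣m         p-prime p∤n zero    {m} _ = 1∣ m
p^i∣m*n⇒p^i∣m {p} {n} p-prime p∤n (suc i) {m} p^[1+i]∣mn
  with euclidsLemma m n p-prime (∣-trans (m∣m*n (p ^ i)) p^[1+i]∣mn)
... | inj₂ p∣n            = contradiction p∣n p∤n
... | inj₁ (divides q refl) =
  subst (p * p ^ i ∣_) (ℕ.*-comm p q) (*-monoʳ-∣ p (p^i∣m*n⇒p^i∣m p-prime p∤n i p^i∣qn))
  where
  instance _ = prime⇒nonZero p-prime
  p^i∣qn : p ^ i ∣ q * n
  p^i∣qn = *-cancelˡ-∣ p (subst (p * p ^ i ∣_) (trans (cong (_* n) (ℕ.*-comm q p)) (ℕ.*-assoc p q n)) p^[1+i]∣mn)

p^i∣n∧m∣n⇒p^i*m∣n : ∀ {p} → Prime p → ∀ i {m n} → ¬ p ∣ m → p ^ i ∣ n → m ∣ n → p ^ i * m ∣ n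
p^i∣n∧m∣n⇒p^i*m∣n p-prime i {m} p∤m p^i∣n (divides q refl) = *-monoˡ-∣ m (p^i∣m*n⇒p^i∣m p-prime p∤m i {q} p^i∣n)

p^[1+e]∣m*n⇒p^e∣m : ∀ {p n} → Prime p → ¬ p * p ∣ n → ∀ e {m} → p ^ suc e ∣ m * n → p ^ e ∣ m
p^[1+e]∣m*n⇒p^e∣m {p} {n} p-prime p²∤n e {m} p^[1+e]∣mn with p ∣? n
... | no p∤n = ∣-trans (n∣m*n p) (p^i∣m*n⇒p^i∣m p-prime p∤n (suc e) p^[1+e]∣mn)
... | yes (divides k refl) = p^i∣m*n⇒p^i∣m p-prime p∤k e (*-cancelʳ-∣ p p^e*p∣mk*p)
  where
  instance _ = prime⇒nonZero p-prime
  p∤k : ¬ p ∣ k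
  p∤k (divides j refl) = p²∤n (subst (p * p ∣_) (sym (ℕ.*-assoc j p p)) (n∣m*n j))
  p^e*p∣mk*p : p ^ e * p ∣ m * k * p
  p^e*p∣mk*p = subst₂ _∣_ (ℕ.*-comm p (p ^ e)) (sym (ℕ.*-assoc m k p)) p^[1+e]∣mn

∣p^[1+e]*c⇒∣p^e*c : ∀ {p} → Prime p → ∀ e {c g} → ¬ p ^ suc e ∣ g → g ∣ p ^ suc e * c → g ∣ p ^ e * c
∣p^[1+e]*c⇒∣p^e*c {p} p-prime e {c} {g} p^[1+e]∤g g∣ with p ∣? g
... | no p∤g = coprime-divisor (Coprime.sym (prime∤⇒coprime p-prime p∤g)) (subst (g ∣_) (ℕ.*-assoc p (p ^ e) c) g∣)
∣p^[1+e]*c⇒∣p^e*c {p} p-prime zero p¹∤g _ | yes p∣g = contradiction (subst (_∣ _) (sym (ℕ.*-identityʳ p)) p∣g) p¹∤g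
∣p^[1+e]*c⇒∣p^e*c {p} p-prime (suc e) {c} p^[2+e]∤qp qp∣ | yes (divides q refl) =
  subst (q * p ∣_) p^e*c*p≡p^[1+e]*c (*-monoˡ-∣ p q∣p^e*c)
  where
  instance _ = prime⇒nonZero p-prime
  p^[1+e]*c*p≡p^[2+e]*c : p ^ suc e * c * p ≡ p ^ suc (suc e) * c
  p^[1+e]*c*p≡p^[2+e]*c = trans (ℕ.*-comm _ p) (sym (ℕ.*-assoc p (p ^ suc e) c))
  p^e*c*p≡p^[1+e]*c : p ^ e * c * p ≡ p ^ suc e * c
  p^e*c*p≡p^[1+e]*c = trans (ℕ.*-comm _ p) (sym (ℕ.*-assoc p (p ^ e) c))
  p^[1+e]∤q : ¬ p ^ suc e ∣ q
  p^[1+e]∤q p^[1+e]∣q = p^[2+e]∤qp (subst (_∣ q * p) (ℕ.*-comm (p ^ suc e) p) (*-monoˡ-∣ p p^[1+e]∣q))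
  q∣p^e*c : q ∣ p ^ e * c
  q∣p^e*c = ∣p^[1+e]*c⇒∣p^e*c p-prime e p^[1+e]∤q (*-cancelʳ-∣ p (subst (q * p ∣_) (sym p^[1+e]*c*p≡p^[2+e]*c) qp∣))

gcd[p^[1+e]*c,t]≡gcd[p^e*c,t] : ∀ {p} → Prime p → ∀ e c {t} → ¬ p ^ suc e ∣ t →
                                gcd (p ^ suc e * c) t ≡ gcd (p ^ e * c) t
gcd[p^[1+e]*c,t]≡gcd[p^e*c,t] {p} p-prime e c {t} p^[1+e]∤t = ∣-antisym
  (gcd-greatest (∣p^[1+e]*c⇒∣p^e*c p-prime e (p^[1+e]∤t ∘ flip ∣-trans (gcd[m,n]∣n (p ^ suc e * c) t))
                                   (gcd[m,n]∣m (p ^ suc e * c) t))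
                (gcd[m,n]∣n (p ^ suc e * c) t))
  (gcd-greatest (∣-trans (gcd[m,n]∣m (p ^ e * c) t) (subst (p ^ e * c ∣_) (sym (ℕ.*-assoc p (p ^ e) c)) (n∣m*n p)))
                (gcd[m,n]∣n (p ^ e * c) t))

p*gcd[p^[1+e]*c,t]∣p^[1+e]*c : ∀ {p} → Prime p → ∀ e c {t} → ¬ p ^ suc e ∣ t →
                               p * gcd (p ^ suc e * c) t ∣ p ^ suc e * c
p*gcd[p^[1+e]*c,t]∣p^[1+e]*c {p} p-prime e c {t} p^[1+e]∤t =
  subst₂ (λ g x → p * g ∣ x) (sym (gcd[p^[1+e]*c,t]≡gcd[p^e*c,t] p-prime e c p^[1+e]∤t)) (sym (ℕ.*-assoc p (p ^ e) c))
         (*-monoʳ-∣ p (gcd[m,n]∣m (p ^ e * c) t))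

∃prime∣ : ∀ n → .{{NonTrivial n}} → Σ[ q ∈ ℕ ] Prime q × q ∣ n
∃prime∣ n@(suc (suc _)) with factorise n
... | record { factors = q ∷ _ ; isFactorisation = n≡ ; factorsPrime = q-prime ∷ _ } =
  q , q-prime , subst (q ∣_) (sym n≡) (m∣m*n _)

PrimePowerPart : ℕ → ℕ → Set
PrimePowerPart p n = Σ[ e ∈ ℕ ] Σ[ m ∈ ℕ ] n ≡ p ^ suc e * m × ¬ p ∣ m

prime-power-part : ∀ {p} → Prime p → ∀ n → .{{NonZero n}} → p ∣ n → PrimePowerPart p n
prime-power-part {p} p-prime = <-rec _ step
  where
  instance _ = prime⇒nonZero p-prime
  step : ∀ n → (∀ {k} → k < n → .{{NonZero k}} → p ∣ k → PrimePowerPart p k) →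
         .{{NonZero n}} → p ∣ n → PrimePowerPart p n
  step .(q * p) rec (divides q refl) with p ∣? q
  ... | no p∤q = 0 , q , trans (ℕ.*-comm q p) (cong (_* q) (sym (ℕ.*-identityʳ p))) , p∤q
  ... | yes p∣q with rec (ℕ.m<m*n q p (prime⇒n>1 p-prime)) p∣q
    where instance _ = ℕ.m*n≢0⇒m≢0 q
  ...   | e , m , q≡p^[1+e]*m , p∤m = suc e , m , qp≡p^[2+e]*m , p∤m
    where
    qp≡p^[2+e]*m : q * p ≡ p ^ suc (suc e) * m
    qp≡p^[2+e]*m = trans (cong (_* p) q≡p^[1+e]*m) (trans (ℕ.*-comm _ p) (sym (ℕ.*-assoc p (p ^ suc e) m)))

ExactPrimePower∤ : ℕ → ℕ → Set
ExactPrimePower∤ X n =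
  Σ[ p ∈ ℕ ] Σ[ e ∈ ℕ ] Σ[ m ∈ ℕ ] Prime p × n ≡ p ^ suc e * m × ¬ p ∣ m × ¬ p ^ suc e ∣ X

exactPrimePower∤-* : ∀ {X q m} e → Prime q → ¬ q ∣ m →
                     ExactPrimePower∤ X m → ExactPrimePower∤ X (q ^ suc e * m)
exactPrimePower∤-* {q = q} {m} e q-prime q∤m (p , e′ , m′ , p-prime , m≡ , p∤m′ , p^[1+e′]∤X) =
  p , e′ , q ^ suc e * m′ , p-prime , n≡ , p∤q^[1+e]*m′ , p^[1+e′]∤X
  where
  n≡ : q ^ suc e * m ≡ p ^ suc e′ * (q ^ suc e * m′)
  n≡ = trans (cong (q ^ suc e *_) m≡) (ℕ*.x∙yz≈y∙xz (q ^ suc e) (p ^ suc e′) m′)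
  p∤q^[1+e]*m′ : ¬ p ∣ q ^ suc e * m′
  p∤q^[1+e]*m′ p∣ with euclidsLemma (q ^ suc e) m′ p-prime p∣
  ... | inj₂ p∣m′ = p∤m′ p∣m′
  ... | inj₁ p∣q^[1+e] with prime⇒irreducible q-prime (p∣m^i⇒p∣m p-prime q (suc e) p∣q^[1+e])
  ...   | inj₁ refl = ¬prime[1] p-prime
  ...   | inj₂ refl = q∤m (subst (p ∣_) (sym m≡) (∣-trans (m∣m*n (p ^ e′)) (m∣m*n m′)))

∤⇒exactPrimePower∤ : ∀ {X} n → .{{NonZero n}} → ¬ n ∣ X → ExactPrimePower∤ X n
∤⇒exactPrimePower∤ {X} = <-rec _ step
  where
  step : ∀ n → (∀ {k} → k < n → .{{NonZero k}} → ¬ k ∣ X → ExactPrimePower∤ X k) →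
         .{{NonZero n}} → ¬ n ∣ X → ExactPrimePower∤ X n
  step 1                rec 1∤X = contradiction (1∣ X) 1∤X
  step n@(suc (suc _)) rec n∤X with ∃prime∣ n
  ... | q , q-prime , q∣n with prime-power-part q-prime n q∣n
  ... | e , m , n≡ , q∤m with q ^ suc e ∣? X | m ∣? X
  ... | no q^[1+e]∤X  | _       = q , e , m , q-prime , n≡ , q∤m , q^[1+e]∤X
  ... | yes q^[1+e]∣X | yes m∣X =
    contradiction (subst (_∣ X) (sym n≡) (p^i∣n∧m∣n⇒p^i*m∣n q-prime (suc e) q∤m q^[1+e]∣X m∣X)) n∤X
  ... | yes _         | no m∤X  =
    subst (ExactPrimePower∤ X) (sym n≡) (exactPrimePower∤-* e q-prime q∤m (rec m<n m∤X))
    where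
    instance
      _ = prime⇒nonZero q-prime
      _ = ℕ.m^n≢0 q e
      m≢0 : NonZero m
      m≢0 = ℕ.m*n≢0⇒n≢0 (q ^ suc e) {{subst NonZero n≡ it}}
    m<n : m < n
    m<n = subst (m <_) (trans (ℕ.*-comm m _) (sym n≡))
                (ℕ.m<m*n m (q ^ suc e) (ℕ.<-≤-trans (prime⇒n>1 q-prime) (ℕ.m≤m*n q (q ^ e))))


-- The Möbius function

∈-primeDivisors⁺ : ∀ {q x} → .{{NonZero x}} → Prime q → q ∣ x → q ∈ primeDivisors x
∈-primeDivisors⁺ {zero}       q-prime _   = contradiction q-prime ¬prime[0]
∈-primeDivisors⁺ {suc _} {x} q-prime q∣x =
  ∈-filter⁺ (λ p → prime? p ×-dec p ∣? x) (∈-map⁺ suc (∈-upTo⁺ (∣⇒≤ q∣x))) (q-prime , q∣x)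

∈-primeDivisors⁻ : ∀ {q} x → q ∈ primeDivisors x → Prime q × q ∣ x
∈-primeDivisors⁻ x q∈ = proj₂ (∈-filter⁻ (λ p → prime? p ×-dec p ∣? x) {xs = map suc (upTo x)} q∈)

foldr-not∧≡not-any? : ∀ {A : Set} {P : A → Set} (P? : Decidable P) xs →
                      foldr (λ x b → not (does (P? x)) ∧ b) true xs ≡ not (does (any? P? xs))
foldr-not∧≡not-any? P? []       = refl
foldr-not∧≡not-any? P? (x ∷ xs) with does (P? x)
... | true  = refl
... | false = foldr-not∧≡not-any? P? xs

squarefree?≡ : ∀ x → squarefree? x ≡ not (does (any? (λ q → q * q ∣? x) (primeDivisors x)))
squarefree?≡ x = foldr-not∧≡not-any? (λ q → q * q ∣? x) (primeDivisors x)

μ-zero : ∀ {p x} → .{{NonZero x}} → Prime p → p * p ∣ x → μ x ≡ + 0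
μ-zero {p} {x} p-prime p²∣x
  rewrite squarefree?≡ x
        | dec-true (any? (λ q → q * q ∣? x) (primeDivisors x))
                   (lose (∈-primeDivisors⁺ p-prime (∣-trans (m∣m*n p) p²∣x)) p²∣x) = refl

squarefree?-* : ∀ {p k} → .{{NonZero k}} → Prime p → ¬ p ∣ k → squarefree? (p * k) ≡ squarefree? k
squarefree?-* {p} {k} p-prime p∤k = begin
  squarefree? (p * k)                                    ≡⟨ squarefree?≡ (p * k) ⟩
  not (does (any? (λ q → q * q ∣? p * k) (primeDivisors (p * k))))
    ≡⟨ cong not (does-⇔ (mk⇔ square∣pk⇒square∣k square∣k⇒square∣pk) (any? _ _) (any? _ _)) ⟩
  not (does (any? (λ q → q * q ∣? k) (primeDivisors k))) ≡⟨ sym (squarefree?≡ k) ⟩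
  squarefree? k                                          ∎
  where
  instance
    _ = prime⇒nonZero p-prime
    _ = ℕ.m*n≢0 p k
  square∣pk⇒square∣k : Any (λ q → q * q ∣ p * k) (primeDivisors (p * k)) →
                       Any (λ q → q * q ∣ k) (primeDivisors k)
  square∣pk⇒square∣k any with find any
  ... | q , q∈ , q²∣pk = lose (∈-primeDivisors⁺ q-prime (∣-trans (m∣m*n q) q²∣k)) q²∣k
    where
    q-prime : Prime q
    q-prime = proj₁ (∈-primeDivisors⁻ (p * k) q∈)
    p∤q : ¬ p ∣ q
    p∤q p∣q with prime⇒irreducible q-prime p∣q
    ... | inj₁ refl = ¬prime[1] p-prime
    ... | inj₂ refl = p∤k (*-cancelˡ-∣ p q²∣pk)
    p∤q² : ¬ p ∣ q * q
    p∤q² p∣q² = [ p∤q , p∤q ]′ (euclidsLemma q q p-prime p∣q²)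
    q²∣k : q * q ∣ k
    q²∣k = coprime-divisor (Coprime.sym (prime∤⇒coprime p-prime p∤q²)) q²∣pk
  square∣k⇒square∣pk : Any (λ q → q * q ∣ k) (primeDivisors k) →
                       Any (λ q → q * q ∣ p * k) (primeDivisors (p * k))
  square∣k⇒square∣pk any with find any
  ... | q , q∈ , q²∣k =
    lose (∈-primeDivisors⁺ (proj₁ (∈-primeDivisors⁻ k q∈)) (∣n⇒∣m*n p (proj₂ (∈-primeDivisors⁻ k q∈))))
         (∣n⇒∣m*n p q²∣k)

length-primeDivisors-* : ∀ {p k} → .{{NonZero k}} → Prime p → ¬ p ∣ k →
                         length (primeDivisors (p * k)) ≡ suc (length (primeDivisors k))
length-primeDivisors-* {p} {k} p-prime p∤k = ℤ.+-injective (begin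
  + length (primeDivisors (p * k))
    ≡⟨ length-filter-upTo (primeDivisor? (p * k)) (p * k) ⟩
  sumTo (𝟙 (primeDivisor? (p * k))) (p * k)
    ≡⟨ sumTo-cong (p * k) (λ j _ → 𝟙-split (suc j)) ⟩
  sumTo (λ q → 𝟙 (primeDivisor? k) q ℤ.+ 𝟙 (_≟ p) q) (p * k)
    ≡⟨ sumTo-+ (𝟙 (primeDivisor? k)) (𝟙 (_≟ p)) (p * k) ⟩
  sumTo (𝟙 (primeDivisor? k)) (p * k) ℤ.+ sumTo (𝟙 (_≟ p)) (p * k)
    ≡⟨ cong₂ ℤ._+_ (sumTo-extend k (p * k) (ℕ.m≤n*m k p) none-beyond-k) (sumTo-𝟙[≟] p (p * k) (ℕ.m≤m*n p k)) ⟩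
  sumTo (𝟙 (primeDivisor? k)) k ℤ.+ + 1
    ≡⟨ cong (ℤ._+ + 1) (sym (length-filter-upTo (primeDivisor? k) k)) ⟩
  + length (primeDivisors k) ℤ.+ + 1
    ≡⟨ cong +_ (ℕ.+-comm _ 1) ⟩
  + suc (length (primeDivisors k)) ∎)
  where
  instance _ = prime⇒nonZero p-prime
  primeDivisor? : ∀ x q → Dec (Prime q × q ∣ x)
  primeDivisor? x q = prime? q ×-dec q ∣? x
  ∣pk⇒∣k : ∀ {q} → q ≢ p → Prime q × q ∣ p * k → Prime q × q ∣ k
  ∣pk⇒∣k q≢p (q-prime , q∣pk) with euclidsLemma p k q-prime q∣pk
  ... | inj₂ q∣k = q-prime , q∣k
  ... | inj₁ q∣p with prime⇒irreducible p-prime q∣p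
  ...   | inj₁ refl = contradiction q-prime ¬prime[1]
  ...   | inj₂ q≡p  = contradiction q≡p q≢p
  𝟙-split : ∀ q → 𝟙 (primeDivisor? (p * k)) q ≡ 𝟙 (primeDivisor? k) q ℤ.+ 𝟙 (_≟ p) q
  𝟙-split q with q ≟ p
  ... | yes refl rewrite dec-true (primeDivisor? (p * k) p) (p-prime , m∣m*n k)
                       | dec-false (primeDivisor? k p) (p∤k ∘ proj₂)
                       | dec-true (p ≟ p) refl = refl
  ... | no q≢p rewrite does-⇔ (mk⇔ (∣pk⇒∣k q≢p) (λ (q-prime , q∣k) → q-prime , ∣n⇒∣m*n p q∣k))
                              (primeDivisor? (p * k) q) (primeDivisor? k q)
                     | dec-false (q ≟ p) q≢p = sym (ℤ.+-identityʳ _)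
  none-beyond-k : ∀ j → k ≤ j → j < p * k → 𝟙 (primeDivisor? k) (suc j) ≡ + 0
  none-beyond-k j k≤j _ = cong (if_then + 1 else + 0)
    (dec-false (primeDivisor? k (suc j)) (λ (_ , q∣k) → ℕ.<⇒≱ (s≤s k≤j) (∣⇒≤ q∣k)))

μ-* : ∀ {p k} → .{{NonZero k}} → Prime p → ¬ p ∣ k → μ (p * k) ≡ - μ k
μ-* {p} {k} p-prime p∤k
  rewrite squarefree?-* p-prime p∤k | length-primeDivisors-* p-prime p∤k with squarefree? k
... | true  = ℤ.-1*i≡-i _
... | false = refl


-- Möbius sums over divisors

divisorTerm : ℕ → (ℕ → ℤ) → ℕ → ℤ
divisorTerm n F zero      = + 0
divisorTerm n F d@(suc _) = if does (d ∣? n) then μ (n / d) ℤ.* F d else + 0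

μ⋆ : (ℕ → ℤ) → ℕ → ℤ
μ⋆ F n = sumTo (divisorTerm n F) n

divisorTerm-∤ : ∀ {n} F d → .{{NonZero d}} → ¬ d ∣ n → divisorTerm n F d ≡ + 0
divisorTerm-∤ {n} F d@(suc _) d∤n = cong (if_then μ (n / d) ℤ.* F d else + 0) (dec-false (d ∣? n) d∤n)

divisorTerm-∣ : ∀ {n} F d → .{{NonZero d}} → ∀ k → n ≡ k * d → divisorTerm n F d ≡ μ k ℤ.* F d
divisorTerm-∣ {n} F d@(suc _) k n≡kd
  rewrite dec-true (d ∣? n) (divides k n≡kd) = cong (λ x → μ x ℤ.* F d) (trans (cong (_/ d) n≡kd) (m*n/n≡m k d))

module _ (F : ℕ → ℤ) {p e m : ℕ} (p-prime : Prime p) .{{_ : NonZero m}} (p∤m : ¬ p ∣ m) where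

  private
    instance
      _ = prime⇒nonZero p-prime
      _ = ℕ.m^n≢0 p e
      _ = ℕ.m*n≢0 (p ^ suc e) m {{ℕ.m^n≢0 p (suc e)}}

    r n : ℕ
    r = p ^ e
    n = p ^ suc e * m

    G G′ : ℕ → ℤ
    G    = divisorTerm n F
    G′ j = G (j * r)

    n≡pm*r : n ≡ p * m * r
    n≡pm*r = ℕ*.xy∙z≈xz∙y p r m

    c*r∣n⇒c∣m : ∀ c → ¬ p ∣ c → c * r ∣ n → c ∣ m
    c*r∣n⇒c∣m c p∤c cr∣n =
      coprime-divisor (Coprime.sym (prime∤⇒coprime p-prime p∤c)) (*-cancelʳ-∣ r (subst (c * r ∣_) n≡pm*r cr∣n))

    c*p*r∣n⇒c∣m : ∀ c → c * p * r ∣ n → c ∣ m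
    c*p*r∣n⇒c∣m c cpr∣n =
      *-cancelʳ-∣ p (subst (c * p ∣_) (ℕ.*-comm p m) (*-cancelʳ-∣ r (subst (c * p * r ∣_) n≡pm*r cpr∣n)))

    G≡0-unless-r∣ : ∀ d → ¬ r ∣ d → G d ≡ + 0
    G≡0-unless-r∣ zero      _   = refl
    G≡0-unless-r∣ d@(suc _) r∤d with d ∣? n
    ... | no d∤n = divisorTerm-∤ F d d∤n
    ... | yes (divides k n≡kd) with p * p ∣? k
    ...   | yes p²∣k = begin
      G d                ≡⟨ divisorTerm-∣ F d k n≡kd ⟩
      μ k ℤ.* F d        ≡⟨ cong (ℤ._* F d) (μ-zero p-prime p²∣k) ⟩
      + 0 ℤ.* F d        ≡⟨ ℤ.*-zeroˡ (F d) ⟩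
      + 0                ∎
      where instance _ = ℕ.m*n≢0⇒m≢0 k {{subst NonZero n≡kd it}}
    ...   | no p²∤k = contradiction (p^[1+e]∣m*n⇒p^e∣m p-prime p²∤k e p^[1+e]∣dk) r∤d
      where
      p^[1+e]∣dk : p ^ suc e ∣ d * k
      p^[1+e]∣dk = subst (p ^ suc e ∣_) (trans n≡kd (ℕ.*-comm k d)) (m∣m*n m)

    sumTo-G≡sumTo-G′ : sumTo G n ≡ sumTo G′ (p * m)
    sumTo-G≡sumTo-G′ = trans (cong (sumTo G) n≡pm*r) (sumTo-*-multiples G r (p * m) G≡0-unless-r∣)

    sumTo-G′-split : sumTo G′ (p * m) ≡ sumTo (λ c → G′ (c * p)) m ℤ.+ sumTo (offMultiples p G′) m
    sumTo-G′-split = begin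
      sumTo G′ (p * m)
        ≡⟨ cong (sumTo G′) (ℕ.*-comm p m) ⟩
      sumTo G′ (m * p)
        ≡⟨ sumTo-*-split G′ p m ⟩
      sumTo (λ c → G′ (c * p)) m ℤ.+ sumTo (offMultiples p G′) (m * p)
        ≡⟨ cong (ℤ._+_ (sumTo (λ c → G′ (c * p)) m)) (sumTo-extend m (m * p) (ℕ.m≤m*n m p) none-beyond-m) ⟩
      sumTo (λ c → G′ (c * p)) m ℤ.+ sumTo (offMultiples p G′) m ∎
      where
      none-beyond-m : ∀ j → m ≤ j → j < m * p → offMultiples p G′ (suc j) ≡ + 0
      none-beyond-m j m≤j _ with p ∣? suc j
      ... | yes _   = refl
      ... | no p∤c = divisorTerm-∤ F (suc j * r) {{ℕ.m*n≢0 (suc j) r}}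
                       (λ cr∣n → ℕ.<⇒≱ (s≤s m≤j) (∣⇒≤ (c*r∣n⇒c∣m (suc j) p∤c cr∣n)))

    pair-cancels : (∀ c → c ∣ m → F (p ^ suc e * c) ≡ F (p ^ e * c)) →
                   ∀ c → .{{NonZero c}} → G′ (c * p) ℤ.+ offMultiples p G′ c ≡ + 0
    pair-cancels F-stable c with c ∣? m
    ... | no c∤m = cong₂ ℤ._+_ (divisorTerm-∤ F (c * p * r) {{ℕ.m*n≢0 (c * p) r {{ℕ.m*n≢0 c p}}}} (c∤m ∘ c*p*r∣n⇒c∣m c))
                               off-c
      where
      off-c : offMultiples p G′ c ≡ + 0
      off-c with p ∣? c
      ... | yes _   = refl
      ... | no p∤c = divisorTerm-∤ F (c * r) {{ℕ.m*n≢0 c r}} (c∤m ∘ c*r∣n⇒c∣m c p∤c)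
    ... | yes (divides k m≡kc) = begin
      G (c * p * r) ℤ.+ offMultiples p G′ c
        ≡⟨ cong (ℤ._+_ (G (c * p * r))) (cong (if_then + 0 else G′ c) (dec-false (p ∣? c) p∤c)) ⟩
      G (c * p * r) ℤ.+ G (c * r)
        ≡⟨ cong₂ ℤ._+_ (divisorTerm-∣ F (c * p * r) {{ℕ.m*n≢0 (c * p) r {{ℕ.m*n≢0 c p}}}} k n≡k*cpr)
                       (divisorTerm-∣ F (c * r) {{ℕ.m*n≢0 c r}} (p * k) n≡pk*cr) ⟩
      μ k ℤ.* F (c * p * r) ℤ.+ μ (p * k) ℤ.* F (c * r)
        ≡⟨ cong₂ (λ x y → μ k ℤ.* x ℤ.+ y ℤ.* F (c * r)) F-cpr≡F-cr (μ-* p-prime p∤k) ⟩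
      μ k ℤ.* F (c * r) ℤ.+ - μ k ℤ.* F (c * r)
        ≡⟨ cong (ℤ._+_ (μ k ℤ.* F (c * r))) (sym (ℤ.neg-distribˡ-* (μ k) (F (c * r)))) ⟩
      μ k ℤ.* F (c * r) ℤ.+ - (μ k ℤ.* F (c * r))
        ≡⟨ ℤ.+-inverseʳ (μ k ℤ.* F (c * r)) ⟩
      + 0 ∎
      where
      p∤c : ¬ p ∣ c
      p∤c p∣c = p∤m (subst (p ∣_) (sym m≡kc) (∣n⇒∣m*n k p∣c))
      p∤k : ¬ p ∣ k
      p∤k p∣k = p∤m (subst (p ∣_) (sym m≡kc) (∣m⇒∣m*n c p∣k))
      instance _ = ℕ.m*n≢0⇒m≢0 k {{subst NonZero m≡kc it}}
      n≡k*cpr : n ≡ k * (c * p * r)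
      n≡k*cpr = trans (cong (p * r *_) m≡kc) (pr[kc]≡k[cpr] p r k c)
        where
        pr[kc]≡k[cpr] : ∀ p r k c → p * r * (k * c) ≡ k * (c * p * r)
        pr[kc]≡k[cpr] = solve-∀
      n≡pk*cr : n ≡ p * k * (c * r)
      n≡pk*cr = trans (cong (p * r *_) m≡kc) (pr[kc]≡pk[cr] p r k c)
        where
        pr[kc]≡pk[cr] : ∀ p r k c → p * r * (k * c) ≡ p * k * (c * r)
        pr[kc]≡pk[cr] = solve-∀
      F-cpr≡F-cr : F (c * p * r) ≡ F (c * r)
      F-cpr≡F-cr = begin
        F (c * p * r)      ≡⟨ cong F (ℕ*.xy∙z≈yz∙x c p r) ⟩
        F (p ^ suc e * c)  ≡⟨ F-stable c (divides k m≡kc) ⟩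
        F (p ^ e * c)      ≡⟨ cong F (ℕ.*-comm r c) ⟩
        F (c * r)          ∎

  μ⋆-vanishes : (∀ c → c ∣ m → F (p ^ suc e * c) ≡ F (p ^ e * c)) → μ⋆ F (p ^ suc e * m) ≡ + 0
  μ⋆-vanishes F-stable = begin
    sumTo G n
      ≡⟨ sumTo-G≡sumTo-G′ ⟩
    sumTo G′ (p * m)
      ≡⟨ sumTo-G′-split ⟩
    sumTo (λ c → G′ (c * p)) m ℤ.+ sumTo (offMultiples p G′) m
      ≡⟨ sym (sumTo-+ (λ c → G′ (c * p)) (offMultiples p G′) m) ⟩
    sumTo (λ c → G′ (c * p) ℤ.+ offMultiples p G′ c) m
      ≡⟨ sumTo-zero m (λ c _ → pair-cancels F-stable (suc c)) ⟩
    + 0 ∎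


gcdWeight : ℕ → ℕ → ℕ → ℤ
gcdWeight a t d = if does (gcd d (t * a) ≟ gcd d t) then (+ a) ℤ.^ gcd d t else + 0

lemma3Sum≡μ⋆ : ∀ n a t → lemma3Sum n a t ≡ μ⋆ (gcdWeight a t) n
lemma3Sum≡μ⋆ n a t = begin
  lemma3Sum n a t
    ≡⟨ ∑ℤ-filter (λ k → gcd (suc k) (t * a) ≟ gcd (suc k) t) _ (divisorsPred n) ⟩
  ∑ℤ (map _ (divisorsPred n))
    ≡⟨ ∑ℤ-filter (λ k → suc k ∣? n) _ (upTo n) ⟩
  ∑ℤ (map _ (upTo n))
    ≡⟨ cong ∑ℤ (List.map-cong summand≗divisorTerm (upTo n)) ⟩
  ∑ℤ (map (λ k → divisorTerm n (gcdWeight a t) (suc k)) (upTo n))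
    ≡⟨ ∑ℤ-upTo (divisorTerm n (gcdWeight a t)) n ⟩
  μ⋆ (gcdWeight a t) n ∎
  where
  summand≗divisorTerm : ∀ k →
    (if does (suc k ∣? n)
      then (if does (gcd (suc k) (t * a) ≟ gcd (suc k) t) then μ (n / suc k) ℤ.* ((+ a) ℤ.^ gcd (suc k) t) else + 0)
      else + 0)
    ≡ divisorTerm n (gcdWeight a t) (suc k)
  summand≗divisorTerm k with does (suc k ∣? n) | does (gcd (suc k) (t * a) ≟ gcd (suc k) t)
  ... | false | _     = refl
  ... | true  | true  = refl
  ... | true  | false = sym (ℤ.*-zeroʳ (μ (n / suc k)))

gcdWeight-zero : ∀ {a t d p} → .{{NonZero t}} → Prime p → p ∣ a → p * gcd d t ∣ d → gcdWeight a t d ≡ + 0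
gcdWeight-zero {a} {t} {d} {p} p-prime p∣a pg∣d =
  cong (if_then (+ a) ℤ.^ gcd d t else + 0) (dec-false (gcd d (t * a) ≟ gcd d t) gcd[d,ta]≢gcd[d,t])
  where
  instance _ = ℕ.≢-nonZero (gcd[m,n]≢0 d t (inj₂ (ℕ.≢-nonZero⁻¹ t)))
  pg∣gcd[d,ta] : p * gcd d t ∣ gcd d (t * a)
  pg∣gcd[d,ta] = gcd-greatest pg∣d (subst (_∣ t * a) (ℕ.*-comm (gcd d t) p) (*-pres-∣ (gcd[m,n]∣n d t) p∣a))
  gcd[d,ta]≢gcd[d,t] : gcd d (t * a) ≢ gcd d t
  gcd[d,ta]≢gcd[d,t] eq = ℕ.<⇒≱ (subst (gcd d t <_) (ℕ.*-comm (gcd d t) p) (ℕ.m<m*n (gcd d t) p (prime⇒n>1 p-prime)))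
                                (∣⇒≤ (subst (p * gcd d t ∣_) eq pg∣gcd[d,ta]))

gcdWeight-stable : ∀ {n a t p} → .{{NonZero t}} → Prime p → p ∣ n → ∀ e → ¬ p ^ suc e ∣ t * gcd n a → ∀ c →
                   gcdWeight a t (p ^ suc e * c) ≡ gcdWeight a t (p ^ e * c)
gcdWeight-stable {n} {a} {t} {p} p-prime p∣n e p^[1+e]∤tb c with p ∣? a
... | no p∤a = cong₂ (λ g h → if does (g ≟ h) then (+ a) ℤ.^ h else + 0)
                     (gcd[p^[1+e]*c,t]≡gcd[p^e*c,t] p-prime e c p^[1+e]∤ta)
                     (gcd[p^[1+e]*c,t]≡gcd[p^e*c,t] p-prime e c p^[1+e]∤t)
  where
  p^[1+e]∤t : ¬ p ^ suc e ∣ t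
  p^[1+e]∤t = p^[1+e]∤tb ∘ ∣m⇒∣m*n (gcd n a)
  p^[1+e]∤ta : ¬ p ^ suc e ∣ t * a
  p^[1+e]∤ta = p^[1+e]∤t ∘ p^i∣m*n⇒p^i∣m p-prime p∤a (suc e)
... | yes p∣a = both-zero e p^[1+e]∤tb
  where
  p∣gcd[n,a] : p ∣ gcd n a
  p∣gcd[n,a] = gcd-greatest p∣n p∣a
  both-zero : ∀ e → ¬ p ^ suc e ∣ t * gcd n a → gcdWeight a t (p ^ suc e * c) ≡ gcdWeight a t (p ^ e * c)
  both-zero zero    p¹∤tb = contradiction (subst (_∣ _) (sym (ℕ.*-identityʳ p)) (∣n⇒∣m*n t p∣gcd[n,a])) p¹∤tb
  both-zero (suc e) p^[2+e]∤tb = trans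
    (gcdWeight-zero p-prime p∣a (p*gcd[p^[1+e]*c,t]∣p^[1+e]*c p-prime (suc e) c (p^[2+e]∤tb ∘ ∣m⇒∣m*n (gcd n a))))
    (sym (gcdWeight-zero p-prime p∣a (p*gcd[p^[1+e]*c,t]∣p^[1+e]*c p-prime e c p^[1+e]∤t)))
    where
    p^[1+e]∤t : ¬ p ^ suc e ∣ t
    p^[1+e]∤t p^[1+e]∣t = p^[2+e]∤tb (subst (_∣ t * gcd n a) (ℕ.*-comm (p ^ suc e) p) (*-pres-∣ p^[1+e]∣t p∣gcd[n,a]))

lemma3 : (n a t : ℕ) → n > 0 → a > 0 → t > 0 →
           ¬ (n ∣ t * gcd n a) →
           lemma3Sum n a t ≡ + 0
-- The hypothesis a > 0 is redundant: for a = 0, gcd n 0 = n divides t * n.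
lemma3 n a t n>0 _ t>0 n∤tb with ∤⇒exactPrimePower∤ n {{ℕ.>-nonZero n>0}} n∤tb
... | p , e , m , p-prime , n≡ , p∤m , p^[1+e]∤tb = begin
  lemma3Sum n a t                     ≡⟨ lemma3Sum≡μ⋆ n a t ⟩
  μ⋆ (gcdWeight a t) n                ≡⟨ cong (μ⋆ (gcdWeight a t)) n≡ ⟩
  μ⋆ (gcdWeight a t) (p ^ suc e * m)  ≡⟨ μ⋆-vanishes (gcdWeight a t) {e = e} p-prime p∤m stable ⟩
  + 0                                 ∎
  where
  instance
    _ = ℕ.>-nonZero t>0
    _ = ℕ.m*n≢0⇒n≢0 (p ^ suc e) {{subst NonZero n≡ (ℕ.>-nonZero n>0)}}
  p∣n : p ∣ n
  p∣n = subst (p ∣_) (sym n≡) (∣m⇒∣m*n m (m∣m*n (p ^ e)))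
  stable : ∀ c → c ∣ m → gcdWeight a t (p ^ suc e * c) ≡ gcdWeight a t (p ^ e * c)
  stable c _ = gcdWeight-stable p-prime p∣n e p^[1+e]∤tb c
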